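{- Let $G$ be an acyclic directed graph with a topological order $<$ of its vertices, and let $(v,w)$ be a new arc with $v>w$, so that its addition triggers a limited search for $v$ from $w$. Suppose the addition of $(v,w)$ does not create a cycle. Let $(x,y)$ be any arc traversed during this (unsuccessful) limited search. Then $v$ and $(x,y)$ are unrelated before the addition of $(v,w)$, and related after it.
   Context: A vertex and an arc of a directed graph are called related if some (directed) path contains both the vertex and the arc (in either order), and unrelated otherwise. Limited search for $v$ from $w$: maintain a set $F$ of visited vertices, initially $\{w\}$, and a set $A$ of arcs to be traversed, initially all arcs $(w,x)$ of the graph before the addition. While $A$ is nonempty, remove an arbitrary arc $(x,y)$ from $A$ (this is a traversal of $(x,y)$); if $y=v$, stop and report a cycle; otherwise, if $y<v$ and $y\notin F$, add $y$ to $F$ and add all arcs $(y,z)$ out of $y$ to $A$. Comparisons use the order $<$ from before the addition. -}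

module Defs where

open import Data.Nat using (ℕ; _<_)
open import Data.Fin using (Fin; _≟_)
open import Data.Product using (_×_; _,_; ∃; Σ)
open import Data.Sum using (_⊎_)
open import Data.List using (List; []; _∷_; _++_)
open import Data.List.Membership.Propositional using (_∈_; _∉_)
open import Data.List.Relation.Unary.Any using (_─_)
open import Data.Bool using (if_then_else_)
open import Relation.Nullary using (¬_)
open import Relation.Nullary.Decidable using (⌊_⌋)
open import Relation.Binary.PropositionalEquality using (_≡_; _≢_)
open import Relation.Binary.Construct.Closure.ReflexiveTransitive using (Star)
open import Relation.Binary.Construct.Closure.Transitive using (TransClosure)
open import Function.Definitions using (Injective)

Graph : ℕ → Set
Graph n = List (Fin n × Fin n)

Arc : ∀ {n} → Graph n → Fin n → Fin n → Set
Arc G a b = (a , b) ∈ G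

Acyclic : ∀ {n} → Graph n → Set
Acyclic G = ∀ a → ¬ TransClosure (Arc G) a a

-- A topological order, represented by an injective rank function
-- (a < b iff rank a < rank b), such that every arc goes up in the order.
IsTopOrder : ∀ {n} → Graph n → (Fin n → ℕ) → Set
IsTopOrder G rank = Injective _≡_ _≡_ rank × (∀ a b → Arc G a b → rank a < rank b)

-- Vertex v and arc (x , y) are related in G: some directed path contains both,
-- i.e. a path v ⇝ x followed by the arc (x , y), or the arc (x , y) followed by
-- a path y ⇝ v.
Related : ∀ {n} → Graph n → Fin n → Fin n × Fin n → Set
Related G v (x , y) = Arc G x y × (Star (Arc G) v x ⊎ Star (Arc G) y v)

Unrelated : ∀ {n} → Graph n → Fin n → Fin n × Fin n → Set
Unrelated G v e = ¬ Related G v e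

outArcs : ∀ {n} → Graph n → Fin n → Graph n
outArcs [] y = []
outArcs ((a , b) ∷ G) y =
  if ⌊ a ≟ y ⌋ then (a , b) ∷ outArcs G y else outArcs G y

-- State of the limited search: visited set F and arcs to be traversed A.
record State (n : ℕ) : Set where
  constructor ⟨_,_⟩
  field
    F : List (Fin n)
    A : List (Fin n × Fin n)

open State public

-- Limited search for v from w in G (G is the graph before the addition,
-- rank the order before the addition).
module LimitedSearch {n : ℕ} (G : Graph n) (rank : Fin n → ℕ) (v w : Fin n) where

  initial : State n
  initial = ⟨ w ∷ [] , outArcs G w ⟩

  -- One non-stopping step: traverse an arbitrary arc (x , y) of A with y ≢ v.
  data Step : State n → State n → Set where
    visit : ∀ {F A x y} (p : (x , y) ∈ A) → y ≢ v →
            rank y < rank v → y ∉ F →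
            Step ⟨ F , A ⟩ ⟨ y ∷ F , (A ─ p) ++ outArcs G y ⟩
    skip  : ∀ {F A x y} (p : (x , y) ∈ A) → y ≢ v →
            ¬ (rank y < rank v × y ∉ F) →
            Step ⟨ F , A ⟩ ⟨ F , A ─ p ⟩

  Reachable : State n → Set
  Reachable = Star Step initial

  -- (x , y) is traversed during (some run of) the search: it lies in A at a
  -- reachable state, so the next step may remove (traverse) it.
  Traversed : Fin n × Fin n → Set
  Traversed e = Σ (State n) λ s → Reachable s × e ∈ A s

module Submission where

-- Every arc (a , b) that ever sits in the to-do set A of the
-- limited search satisfies the invariant
--     (a , b) is an arc of G,  w ⇝ a in G,  and  a < v,
-- because the search only adds the out-arcs of w (initially) and of vertices
-- y < v that it reached through such an arc.  For a traversed arc (x , y):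
--   * related after the addition: v → w ⇝ x → y is a path through (v , w);
--   * unrelated before: a path v ⇝ x in G would give v ≤ x, contradicting
--     x < v since G's arcs go up in the order; a path y ⇝ v in G would give
--     w ⇝ x → y ⇝ v, which together with the new arc (v , w) is a cycle.

open import Defs
open import Data.Nat using (ℕ; _<_; _≤_)
open import Data.Nat.Properties using (≤-refl; ≤-trans; <⇒≤; <-≤-trans; <-irrefl)
open import Data.Fin using (Fin; _≟_)
open import Data.Product using (_×_; _,_)
open import Data.Sum using (inj₁; inj₂)
open import Data.List using ([]; _∷_)
open import Data.List.Relation.Unary.All as All using (All)
open import Data.List.Relation.Unary.All.Properties using (++⁺; ─⁺)
open import Data.List.Relation.Unary.Any using (here; there)
open import Relation.Nullary using (yes; no)
open import Relation.Binary.PropositionalEquality using (refl)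
open import Relation.Binary.Construct.Closure.ReflexiveTransitive
  using (Star; ε; _◅_; _◅◅_; fold)
  renaming (map to mapStar)
open import Relation.Binary.Construct.Closure.Transitive using (TransClosure; [_]; _∷_)

star-preserves : ∀ {S : Set} {R : S → S → Set} (P : S → Set) →
                 (∀ {s t} → R s t → P s → P t) →
                 ∀ {s t} → Star R s t → P s → P t
star-preserves P step = fold (λ s t → P s → P t) (λ r k p → k (step r p)) (λ p → p)

step-then-star : ∀ {S : Set} {R : S → S → Set} {a b c} →
                 R a b → Star R b c → TransClosure R a c
step-then-star r ε = [ r ]
step-then-star r (r′ ◅ rs) = r ∷ step-then-star r′ rs

module _ {n : ℕ} where

  rank-monotone : (G : Graph n) (rank : Fin n → ℕ) →
                  (∀ a b → Arc G a b → rank a < rank b) →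
                  ∀ {a b} → Star (Arc G) a b → rank a ≤ rank b
  rank-monotone G rank up =
    fold (λ a b → rank a ≤ rank b) (λ {a} {b} h r → ≤-trans (<⇒≤ (up a b h)) r) ≤-refl

  weaken : (G : Graph n) (e : Fin n × Fin n) →
           ∀ {a b} → Star (Arc G) a b → Star (Arc (e ∷ G)) a b
  weaken G e = mapStar there

  closes-cycle : (G : Graph n) {v w : Fin n} →
                 Star (Arc G) w v → TransClosure (Arc ((v , w) ∷ G)) v v
  closes-cycle G {v} {w} w⇝v = step-then-star (here refl) (weaken G (v , w) w⇝v)

  outArcs-all : (G : Graph n) (y : Fin n) (P : Fin n × Fin n → Set) →
                (∀ {b} → Arc G y b → P (y , b)) → All P (outArcs G y)
  outArcs-all []             y P out = All.[]
  outArcs-all ((a , b) ∷ G) y P out with a ≟ y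
  ... | yes refl = out (here refl) All.∷ outArcs-all G y P (λ h → out (there h))
  ... | no _     = outArcs-all G y P (λ h → out (there h))

  module SearchInvariant (G : Graph n) (rank : Fin n → ℕ) (v w : Fin n)
                         (w<v : rank w < rank v) where
    open LimitedSearch G rank v w

    Pending : Fin n × Fin n → Set
    Pending (a , b) = Arc G a b × Star (Arc G) w a × rank a < rank v

    Invariant : State n → Set
    Invariant s = All Pending (A s)

    initial-ok : Invariant initial
    initial-ok = outArcs-all G w Pending (λ h → h , ε , w<v)

    -- Removing an arc keeps the invariant; a newly visited y (reached by a
    -- pending arc (x , y), with y < v) contributes out-arcs with tail y,
    -- and w ⇝ x → y.
    step-ok : ∀ {s t} → Step s t → Invariant s → Invariant t
    step-ok (visit p _ y<v _) inv with All.lookup inv p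
    ... | x→y , w⇝x , _ =
      ++⁺ (─⁺ p inv) (outArcs-all G _ Pending (λ h → h , w⇝x ◅◅ (x→y ◅ ε) , y<v))
    step-ok (skip p _ _) inv = ─⁺ p inv

    traversed-pending : ∀ {e} → Traversed e → Pending e
    traversed-pending (_ , reach , e∈A) =
      All.lookup (star-preserves Invariant step-ok reach initial-ok) e∈A

lemma2p1 : (n : ℕ) (G : Graph n) (rank : Fin n → ℕ) (v w : Fin n) →
           Acyclic G → IsTopOrder G rank → rank w < rank v →
           Acyclic ((v , w) ∷ G) →
           (x y : Fin n) → LimitedSearch.Traversed G rank v w (x , y) →
           Unrelated G v (x , y) × Related ((v , w) ∷ G) v (x , y)
lemma2p1 n G rank v w _ (_ , up) w<v acyclic′ x y traversed
  with SearchInvariant.traversed-pending G rank v w w<v traversed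
... | x→y , w⇝x , x<v =
  unrelated , (there x→y , inj₁ (here refl ◅ weaken G (v , w) w⇝x))
  where
    -- v ⇝ x contradicts x < v; y ⇝ v closes the cycle v → w ⇝ x → y ⇝ v.
    unrelated : Unrelated G v (x , y)
    unrelated (_ , inj₁ v⇝x) = <-irrefl refl (<-≤-trans x<v (rank-monotone G rank up v⇝x))
    unrelated (_ , inj₂ y⇝v) = acyclic′ v (closes-cycle G (w⇝x ◅◅ (x→y ◅ y⇝v)))
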